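{- Let $\overrightarrow{G}$ be a connected oriented graph that is isomorphic to every oriented graph push equivalent to it. Then $\overrightarrow{G}$ is the one-vertex graph $\overrightarrow{K}_1$, an orientation $\overrightarrow{K}_2$ of the complete graph on two vertices, or a non-directable oriented $4$-cycle.
   Context: An oriented graph has no loops and at most one arc between two vertices. To push a vertex means to reverse all arcs incident to it; to push a set pushes each vertex once; two oriented graphs are push equivalent if one is obtained from the other by pushing a vertex set. An oriented $4$-cycle $v_1v_2v_3v_4v_1$ is non-directable if, with respect to the traversal $v_1\to v_2\to v_3\to v_4\to v_1$, it has an odd number of forward arcs (arcs oriented $v_iv_{i+1}$, indices mod 4); equivalently, no pushing of vertices turns it into a directed cycle. -}

module Defs where

open import Data.Nat using (ℕ; zero; suc; _+_; _<_; _%_)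
open import Data.Bool using (Bool; true; false; if_then_else_; _∨_; _xor_)
open import Data.Fin using (Fin; zero; suc)
open import Data.Product using (Σ; ∃; _×_; _,_)
open import Data.Sum using (_⊎_)
open import Function.Bundles using (_↔_; Inverse)
open import Relation.Binary.PropositionalEquality using (_≡_)
open import Relation.Binary.Construct.Closure.ReflexiveTransitive using (Star)

-- A digraph on the vertex set Fin n, given by its arc indicator:
-- arc u v ≡ true  iff  there is an arc from u to v.
Digraph : ℕ → Set
Digraph n = Fin n → Fin n → Bool

record IsOriented {n : ℕ} (G : Digraph n) : Set where
  field
    noLoop : ∀ v → G v v ≡ false
    asym   : ∀ u v → G u v ≡ true → G v u ≡ false

adj : ∀ {n} → Digraph n → Fin n → Fin n → Bool
adj G u v = G u v ∨ G v u

record Connected {n : ℕ} (G : Digraph n) : Set where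
  field
    nonempty : 0 < n
    walk     : ∀ u v → Star (λ x y → adj G x y ≡ true) u v

-- Pushing the vertex set S (S v ≡ true iff v ∈ S): an arc is reversed
-- iff exactly one of its ends lies in S (pushing both ends reverses it twice).
push : ∀ {n} → (Fin n → Bool) → Digraph n → Digraph n
push S G u v = if S u xor S v then G v u else G u v

PushEquivalent : ∀ {n} → Digraph n → Digraph n → Set
PushEquivalent {n} G H = Σ (Fin n → Bool) λ S → ∀ u v → H u v ≡ push S G u v

Isomorphic : ∀ {n} → Digraph n → Digraph n → Set
Isomorphic {n} G H =
  Σ (Fin n ↔ Fin n) λ f → ∀ u v → H (Inverse.to f u) (Inverse.to f v) ≡ G u v

IsK1 : ∀ {n} → Digraph n → Set
IsK1 {n} G = Fin 1 ↔ Fin n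

IsOrientedK2 : ∀ {n} → Digraph n → Set
IsOrientedK2 {n} G =
  Σ (Fin 2 ↔ Fin n) λ v →
    adj G (Inverse.to v zero) (Inverse.to v (suc zero)) ≡ true

next4 : Fin 4 → Fin 4
next4 zero = suc zero
next4 (suc zero) = suc (suc zero)
next4 (suc (suc zero)) = suc (suc (suc zero))
next4 (suc (suc (suc zero))) = zero

c0 c1 c2 c3 : Fin 4
c0 = zero
c1 = suc zero
c2 = suc (suc zero)
c3 = suc (suc (suc zero))

cycleAdj : Fin 4 → Fin 4 → Bool
cycleAdj zero zero = false
cycleAdj zero (suc zero) = true
cycleAdj zero (suc (suc zero)) = false
cycleAdj zero (suc (suc (suc zero))) = true
cycleAdj (suc zero) zero = true
cycleAdj (suc zero) (suc zero) = false
cycleAdj (suc zero) (suc (suc zero)) = true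
cycleAdj (suc zero) (suc (suc (suc zero))) = false
cycleAdj (suc (suc zero)) zero = false
cycleAdj (suc (suc zero)) (suc zero) = true
cycleAdj (suc (suc zero)) (suc (suc zero)) = false
cycleAdj (suc (suc zero)) (suc (suc (suc zero))) = true
cycleAdj (suc (suc (suc zero))) zero = true
cycleAdj (suc (suc (suc zero))) (suc zero) = false
cycleAdj (suc (suc (suc zero))) (suc (suc zero)) = true
cycleAdj (suc (suc (suc zero))) (suc (suc (suc zero))) = false

b2n : Bool → ℕ
b2n true = 1
b2n false = 0

-- G is a non-directable oriented 4-cycle: its vertices can be enumerated
-- v1 v2 v3 v4 (bijection Fin 4 ↔ Fin n) so that the underlying graph is
-- exactly the cycle v1v2v3v4v1, and the number of forward arcs
-- v_i → v_{i+1} (indices mod 4) is odd.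
IsNonDirectable4Cycle : ∀ {n} → Digraph n → Set
IsNonDirectable4Cycle {n} G =
  Σ (Fin 4 ↔ Fin n) λ v →
    let w = Inverse.to v
        fwd : Fin 4 → ℕ
        fwd i = b2n (G (w i) (w (next4 i)))
    in (∀ i j → adj G (w i) (w j) ≡ cycleAdj i j)
       × ((fwd c0 + fwd c1 + fwd c2 + fwd c3) % 2 ≡ 1)

-- Every graph push equivalent to G is isomorphic to G, so properties of sources transfer
-- between all members of the push class.  Pushing the in-neighbours of a vertex makes it a
-- source, so every member has a source.  Growing a vertex set along the edges of the connected
-- graph, and orienting each new edge away from the set by a push, yields a member in which a
-- chosen vertex is the only possible source, and, starting from a directed cycle, a member
-- without a source; hence every member has exactly one source and no directed cycle.
-- Now let v be the source of a member H.  Pushing v, single neighbours of v, or vertices at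
-- distance at least two from v (which keeps v a source), and comparing sources shows: the
-- neighbours of v are pairwise nonadjacent; every other vertex has an in- and an out-neighbour
-- among them; any two neighbours of v have a common further neighbour whose arcs to them point
-- opposite ways; hence v has at most two neighbours, and with two neighbours there is exactly
-- one further vertex.  So G is K₁, K₂ or a 4-cycle, and the parity of the forward arcs of the
-- 4-cycle, which pushing preserves, is odd in H.

module Submission where

open import Defs
open import Data.Nat using (ℕ; zero; suc; _+_; _≤_; _<_; _%_)
open import Data.Nat.Properties using (≤-trans; <⇒≱; +-suc; +-monoʳ-≤; m≤m+n; module ≤-Reasoning)
open import Data.Bool using (Bool; true; false; not; _∧_; _∨_; _xor_; if_then_else_)
open import Data.Bool.Properties
  using (∨-comm; ∨-conicalˡ; ∨-identityʳ; xor-same; xor-inverseʳ; xor-inverseˡ; xor-identityʳ; ¬-not; xor-∧-commutativeRing)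
  renaming (_≟_ to _≟ᵇ_)
open import Data.Fin using (Fin; zero; suc; _≟_; fromℕ<)
open import Data.Fin.Properties using (any?)
open import Data.Fin.Subset using (Subset; _∈_; _∪_; ⁅_⁆; ∣_∣)
  renaming (⊥ to ∅)
open import Data.Fin.Subset.Properties
  using (_∈?_; ∉⊥; x∈⁅x⁆; x∈⁅y⁆⇒x≡y; x∈p∪q⁺; x∈p∪q⁻; p⊆p∪q; p⊂q⇒∣p∣<∣q∣; ∣p∣≤n)
open import Data.Vec using (Vec; []; _∷_; lookup)
open import Data.Vec.Membership.Propositional using () renaming (_∈_ to _∈ᵛ_)
open import Data.Vec.Relation.Unary.Any using (here; there; index)
open import Data.Vec.Relation.Unary.Any.Properties using (lookup-index)
open import Data.Vec.Relation.Unary.All using ([]; _∷_)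
open import Data.Vec.Relation.Unary.Unique.Propositional using (Unique; []; _∷_)
open import Data.Vec.Relation.Unary.Unique.Propositional.Properties using (lookup-injective)
open import Data.Product using (∃; ∃₂; _×_; _,_; proj₁; proj₂)
open import Data.Sum using (_⊎_; inj₁; inj₂)
open import Data.Empty using (⊥; ⊥-elim)
open import Function.Base using (_∘_)
open import Function.Bundles using (_↔_; Inverse; Injection; mk↔ₛ′)
open import Function.Properties.Inverse using (↔-sym; ↔⇒↣)
open import Relation.Nullary using (¬_; yes; no; does; ¬?; _×-dec_; decidable-stable)
open import Relation.Nullary.Decidable using (dec-true; dec-false)
open import Level using (0ℓ)
open import Relation.Unary using (Pred; Decidable)
open import Relation.Binary.PropositionalEquality
  using (_≡_; _≢_; refl; sym; trans; cong; cong₂; module ≡-Reasoning)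
open import Relation.Binary.Construct.Closure.ReflexiveTransitive using (Star; ε; _◅_)
open import Algebra.Solver.Ring.AlmostCommutativeRing using (fromCommutativeRing)
import Algebra.Solver.Ring.Simple as RingSolver

private
  variable
    n k : ℕ
    c : Bool
    G H K K′ : Digraph n
    a b r t u w x y z z₁ z₂ : Fin n
    γ : Fin 4 → Fin n

module BoolRing = RingSolver (fromCommutativeRing xor-∧-commutativeRing) _≟ᵇ_

xor-telescope : ∀ s₀ s₁ s₂ s₃ k₀ k₁ k₂ k₃ →
  ((s₀ xor s₁) xor k₀) xor ((s₁ xor s₂) xor k₁) xor ((s₂ xor s₃) xor k₂) xor ((s₃ xor s₀) xor k₃)
    ≡ k₀ xor k₁ xor k₂ xor k₃
xor-telescope = solve 8 (λ s₀ s₁ s₂ s₃ k₀ k₁ k₂ k₃ →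
  ((s₀ :+ s₁) :+ k₀) :+ (((s₁ :+ s₂) :+ k₁) :+ (((s₂ :+ s₃) :+ k₂) :+ ((s₃ :+ s₀) :+ k₃)))
    := k₀ :+ (k₁ :+ (k₂ :+ k₃))) refl
  where open BoolRing

true≢false : true ≢ false
true≢false ()

bool-pigeonhole : (p q s : Bool) → p ≡ q ⊎ q ≡ s ⊎ p ≡ s
bool-pigeonhole true  true  _     = inj₁ refl
bool-pigeonhole false false _     = inj₁ refl
bool-pigeonhole true  false true  = inj₂ (inj₂ refl)
bool-pigeonhole true  false false = inj₂ (inj₁ refl)
bool-pigeonhole false true  true  = inj₂ (inj₁ refl)
bool-pigeonhole false true  false = inj₂ (inj₂ refl)

b2n-sum-parity : (p q s t : Bool) → (b2n p + b2n q + b2n s + b2n t) % 2 ≡ b2n (p xor q xor s xor t)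
b2n-sum-parity true  true  true  true  = refl
b2n-sum-parity true  true  true  false = refl
b2n-sum-parity true  true  false true  = refl
b2n-sum-parity true  true  false false = refl
b2n-sum-parity true  false true  true  = refl
b2n-sum-parity true  false true  false = refl
b2n-sum-parity true  false false true  = refl
b2n-sum-parity true  false false false = refl
b2n-sum-parity false true  true  true  = refl
b2n-sum-parity false true  true  false = refl
b2n-sum-parity false true  false true  = refl
b2n-sum-parity false true  false false = refl
b2n-sum-parity false false true  true  = refl
b2n-sum-parity false false true  false = refl
b2n-sum-parity false false false true  = refl
b2n-sum-parity false false false false = refl

-- Digraphs and pushing

⁅_⁆ᵇ : Fin n → Fin n → Bool
⁅ y ⁆ᵇ u = does (u ≟ y)

⁅⁆ᵇ-self : (y : Fin n) → ⁅ y ⁆ᵇ y ≡ true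
⁅⁆ᵇ-self y = dec-true (y ≟ y) refl

⁅⁆ᵇ-other : u ≢ y → ⁅ y ⁆ᵇ u ≡ false
⁅⁆ᵇ-other {u = u} {y = y} = dec-false (u ≟ y)

IsSource : Digraph n → Fin n → Set
IsSource K u = ∀ x → K x u ≡ false

AtMostOneSource : Digraph n → Set
AtMostOneSource K = ∀ {a b} → IsSource K a → IsSource K b → a ≡ b

adj-sym : (K : Digraph n) (u w : Fin n) → adj K u w ≡ adj K w u
adj-sym K u w = ∨-comm (K u w) (K w u)

arc⇒adj : K u w ≡ true → adj K u w ≡ true
arc⇒adj e rewrite e = refl

adj-irreflexive : IsOriented K → adj K u u ≡ false
adj-irreflexive {u = u} o rewrite IsOriented.noLoop o u = refl

adjacent⇒distinct : IsOriented K → adj K u w ≡ true → u ≢ w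
adjacent⇒distinct o e refl = true≢false (trans (sym e) (adj-irreflexive o))

converse-arc : IsOriented K → adj K u w ≡ true → K w u ≡ not (K u w)
converse-arc {K = K} {u = u} {w = w} o e with K u w in uw
... | true  = IsOriented.asym o u w uw
... | false = e

nonadjacent⇒no-arc : adj K u w ≡ false → K u w ≡ false
nonadjacent⇒no-arc {K = K} {u = u} {w = w} = ∨-conicalˡ (K u w) (K w u)

oriented-resp : (∀ u w → H u w ≡ K u w) → IsOriented K → IsOriented H
oriented-resp H≡K o = record
  { noLoop = λ u → trans (H≡K u u) (IsOriented.noLoop o u)
  ; asym   = λ u w e → trans (H≡K w u) (IsOriented.asym o u w (trans (sym (H≡K u w)) e))
  }

push-inside : (S : Fin n → Bool) (K : Digraph n) → S u ≡ c → S w ≡ c → push S K u w ≡ K u w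
push-inside {c = c} S K p q rewrite p | q | xor-same c = refl

push-across : (S : Fin n → Bool) (K : Digraph n) → S u ≡ c → S w ≡ not c → push S K u w ≡ K w u
push-across {c = c} S K p q rewrite p | q | xor-inverseʳ c = refl

push-cong : (S : Fin n → Bool) → (∀ u w → H u w ≡ K u w) → ∀ u w → push S H u w ≡ push S K u w
push-cong S H≡K u w with S u xor S w
... | true  = H≡K w u
... | false = H≡K u w

adj-push : (S : Fin n → Bool) (K : Digraph n) (u w : Fin n) → adj (push S K) u w ≡ adj K u w
adj-push S K u w with S u | S w
... | true  | true  = refl
... | false | false = refl
... | true  | false = adj-sym K w u
... | false | true  = adj-sym K w u

push-nonadjacent : (S : Fin n → Bool) (K : Digraph n) → adj K u w ≡ false → push S K u w ≡ false
push-nonadjacent {u = u} {w = w} S K e = nonadjacent⇒no-arc {K = push S K} (trans (adj-push S K u w) e)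

push-oriented : (S : Fin n → Bool) → IsOriented K → IsOriented (push S K)
push-oriented {K = K} S o = record { noLoop = noLoop′ ; asym = asym′ }
  where
  open IsOriented o
  noLoop′ : ∀ u → push S K u u ≡ false
  noLoop′ u = trans (push-inside S K refl refl) (noLoop u)
  asym′ : ∀ u w → push S K u w ≡ true → push S K w u ≡ false
  asym′ u w with S u | S w
  ... | true  | true  = asym u w
  ... | false | false = asym u w
  ... | true  | false = asym w u
  ... | false | true  = asym w u

push-push : (T S : Fin n → Bool) (K : Digraph n) (u w : Fin n) →
  push T (push S K) u w ≡ push (λ i → T i xor S i) K u w
push-push T S K u w with T u | T w | S u | S w
... | true  | true  | true  | true  = refl
... | true  | true  | true  | false = refl
... | true  | true  | false | true  = refl
... | true  | true  | false | false = refl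
... | true  | false | true  | true  = refl
... | true  | false | true  | false = refl
... | true  | false | false | true  = refl
... | true  | false | false | false = refl
... | false | true  | true  | true  = refl
... | false | true  | true  | false = refl
... | false | true  | false | true  = refl
... | false | true  | false | false = refl
... | false | false | true  | true  = refl
... | false | false | true  | false = refl
... | false | false | false | true  = refl
... | false | false | false | false = refl

push-involutive : (S : Fin n → Bool) (K : Digraph n) (u w : Fin n) → push S (push S K) u w ≡ K u w
push-involutive S K u w =
  trans (push-push S S K u w) (push-inside (λ i → S i xor S i) K (xor-same (S u)) (xor-same (S w)))

push-adjacent : (S : Fin n → Bool) → IsOriented K → adj K u w ≡ true →
  push S K u w ≡ (S u xor S w) xor K u w
push-adjacent {u = u} {w = w} S o e with S u xor S w
... | false = refl
... | true  = converse-arc o e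

push-in-neighbours-source : IsOriented K → IsSource (push (λ u → K u r) K) r
push-in-neighbours-source {K = K} {r = r} o x = by-cases (K x r) refl
  where
  open IsOriented o
  by-cases : ∀ c → K x r ≡ c → push (λ u → K u r) K x r ≡ false
  by-cases true  e = trans (push-across (λ u → K u r) K e (noLoop r)) (asym x r e)
  by-cases false e = trans (push-inside (λ u → K u r) K e (noLoop r)) e

push-single-away : (K : Digraph n) → a ≢ y → b ≢ y → push ⁅ y ⁆ᵇ K a b ≡ K a b
push-single-away {y = y} K a≢y b≢y = push-inside ⁅ y ⁆ᵇ K (⁅⁆ᵇ-other a≢y) (⁅⁆ᵇ-other b≢y)

push-single-out : (K : Digraph n) → b ≢ y → push ⁅ y ⁆ᵇ K y b ≡ K b y
push-single-out {y = y} K b≢y = push-across ⁅ y ⁆ᵇ K (⁅⁆ᵇ-self y) (⁅⁆ᵇ-other b≢y)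

push-single-in : (K : Digraph n) → a ≢ y → push ⁅ y ⁆ᵇ K a y ≡ K y a
push-single-in {y = y} K a≢y = push-across ⁅ y ⁆ᵇ K (⁅⁆ᵇ-other a≢y) (⁅⁆ᵇ-self y)

iso-sym : Isomorphic G H → Isomorphic H G
iso-sym {G = G} {H = H} (f , preserves) = ↔-sym f , λ u w → begin
  G (from u) (from w)               ≡⟨ sym (preserves (from u) (from w)) ⟩
  H (to (from u)) (to (from w))     ≡⟨ cong₂ H (strictlyInverseˡ u) (strictlyInverseˡ w) ⟩
  H u w                             ∎
  where
  open Inverse f
  open ≡-Reasoning

source-iso : ((f , _) : Isomorphic G H) → IsSource G u → IsSource H (Inverse.to f u)
source-iso {G = G} {H = H} {u = u} (f , preserves) u-source x = begin
  H x (to u)              ≡⟨ cong (λ y → H y (to u)) (sym (strictlyInverseˡ x)) ⟩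
  H (to (from x)) (to u)  ≡⟨ preserves (from x) u ⟩
  G (from x) u            ≡⟨ u-source (from x) ⟩
  false                   ∎
  where
  open Inverse f
  open ≡-Reasoning

at-most-one-source-iso : Isomorphic G H → AtMostOneSource H → AtMostOneSource G
at-most-one-source-iso {G = G} {H = H} I@(f , _) unique a-source b-source =
  Injection.injective (↔⇒↣ f) (unique (source-iso {H = H} I a-source) (source-iso {H = H} I b-source))

module _ {A : Set} {E : A → A → Set} where

  exit : {P : Pred A 0ℓ} {a b : A} → Decidable P → Star E a b → P a → ¬ P b → ∃₂ λ x y → P x × ¬ P y × E x y
  exit P? ε pa ¬pb = ⊥-elim (¬pb pa)
  exit P? (_◅_ {j = c} e rest) pa ¬pb with P? c
  ... | yes pc = exit P? rest pc ¬pb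
  ... | no ¬pc = _ , c , pa , ¬pc , e

  first-step : {a b : A} → Star E a b → a ≢ b → ∃ (E a)
  first-step ε a≢b = ⊥-elim (a≢b refl)
  first-step (e ◅ _) _ = _ , e

module _ {P : Pred (Fin n) 0ℓ} (P? : Decidable P) where

  none-one-two-or-three :
      (∀ u → ¬ P u)
    ⊎ (∃ λ x → P x × ∀ u → P u → u ≡ x)
    ⊎ (∃₂ λ x y → x ≢ y × P x × P y × ∀ u → P u → u ≡ x ⊎ u ≡ y)
    ⊎ (∃₂ λ x y → ∃ λ w → x ≢ y × x ≢ w × y ≢ w × P x × P y × P w)
  none-one-two-or-three with any? P?
  ... | no ∄x = inj₁ λ u pu → ∄x (u , pu)
  ... | yes (x , px) with any? (λ u → P? u ×-dec ¬? (u ≟ x))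
  ...   | no ∄y = inj₂ (inj₁ (x , px , λ u pu → decidable-stable (u ≟ x) λ u≢x → ∄y (u , pu , u≢x)))
  ...   | yes (y , py , y≢x) with any? (λ u → P? u ×-dec ¬? (u ≟ x) ×-dec ¬? (u ≟ y))
  ...     | yes (w , pw , w≢x , w≢y) =
    inj₂ (inj₂ (inj₂ (x , y , w , y≢x ∘ sym , w≢x ∘ sym , w≢y ∘ sym , px , py , pw)))
  ...     | no ∄w = inj₂ (inj₂ (inj₁ (x , y , y≢x ∘ sym , px , py , x-or-y)))
    where
    x-or-y : ∀ u → P u → u ≡ x ⊎ u ≡ y
    x-or-y u pu with u ≟ x
    ... | yes u≡x = inj₁ u≡x
    ... | no  u≢x = inj₂ (decidable-stable (u ≟ y) λ u≢y → ∄w (u , pu , u≢x , u≢y))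

enumeration : (xs : Vec (Fin n) k) → Unique xs → (∀ u → u ∈ᵛ xs) → Fin k ↔ Fin n
enumeration xs unique complete = mk↔ₛ′ (lookup xs) (λ u → index (complete u)) lookup-index′ index-lookup
  where
  lookup-index′ : ∀ u → lookup xs (index (complete u)) ≡ u
  lookup-index′ u = sym (lookup-index (complete u))
  index-lookup : ∀ i → index (complete (lookup xs i)) ≡ i
  index-lookup i = lookup-injective unique _ i (lookup-index′ (lookup xs i))

-- Forward arcs around a 4-cycle

forward : Digraph n → (Fin 4 → Fin n) → Fin 4 → Bool
forward K γ i = K (γ i) (γ (next4 i))

forward-parity : Digraph n → (Fin 4 → Fin n) → Bool
forward-parity K γ = forward K γ c0 xor forward K γ c1 xor forward K γ c2 xor forward K γ c3

InducedSquare : Digraph n → (Fin 4 → Fin n) → Set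
InducedSquare K γ = ∀ i j → adj K (γ i) (γ j) ≡ cycleAdj i j

forward-parity-push : (S : Fin n → Bool) → IsOriented K → InducedSquare K γ →
  forward-parity (push S K) γ ≡ forward-parity K γ
forward-parity-push {γ = γ} S o square
  rewrite push-adjacent S o (square c0 c1) | push-adjacent S o (square c1 c2)
        | push-adjacent S o (square c2 c3) | push-adjacent S o (square c3 c0)
  = xor-telescope (S (γ c0)) (S (γ c1)) (S (γ c2)) (S (γ c3)) _ _ _ _

forward-parity-push-equivalent : IsOriented K → InducedSquare K γ → PushEquivalent K K′ →
  forward-parity K′ γ ≡ forward-parity K γ
forward-parity-push-equivalent {γ = γ} o square (S , K′≡)
  rewrite K′≡ (γ c0) (γ c1) | K′≡ (γ c1) (γ c2) | K′≡ (γ c2) (γ c3) | K′≡ (γ c3) (γ c0)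
  = forward-parity-push S o square

square-adjacency : IsOriented K → (γ : Fin 4 → Fin n) →
  adj K (γ c0) (γ c1) ≡ true → adj K (γ c1) (γ c2) ≡ true →
  adj K (γ c2) (γ c3) ≡ true → adj K (γ c3) (γ c0) ≡ true →
  adj K (γ c0) (γ c2) ≡ false → adj K (γ c1) (γ c3) ≡ false → InducedSquare K γ
square-adjacency {K = K} o γ e01 e12 e23 e30 d02 d13 = table
  where
  flip : ∀ {i j c} → adj K (γ i) (γ j) ≡ c → adj K (γ j) (γ i) ≡ c
  flip {i} {j} e = trans (adj-sym K (γ j) (γ i)) e
  table : ∀ i j → adj K (γ i) (γ j) ≡ cycleAdj i j
  table zero                   zero                   = adj-irreflexive o
  table zero                   (suc zero)             = e01
  table zero                   (suc (suc zero))       = d02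
  table zero                   (suc (suc (suc zero))) = flip e30
  table (suc zero)             zero                   = flip e01
  table (suc zero)             (suc zero)             = adj-irreflexive o
  table (suc zero)             (suc (suc zero))       = e12
  table (suc zero)             (suc (suc (suc zero))) = d13
  table (suc (suc zero))       zero                   = flip d02
  table (suc (suc zero))       (suc zero)             = flip e12
  table (suc (suc zero))       (suc (suc zero))       = adj-irreflexive o
  table (suc (suc zero))       (suc (suc (suc zero))) = e23
  table (suc (suc (suc zero))) zero                   = e30
  table (suc (suc (suc zero))) (suc zero)             = flip d13
  table (suc (suc (suc zero))) (suc (suc zero))       = flip e23
  table (suc (suc (suc zero))) (suc (suc (suc zero))) = adj-irreflexive o

-- The push class of an oriented graph

⁅_⁆ᵛ : Vec (Fin n) k → Subset n
⁅ [] ⁆ᵛ     = ∅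
⁅ x ∷ xs ⁆ᵛ = ⁅ x ⁆ ∪ ⁅ xs ⁆ᵛ

∈ᵛ⇒∈⁅⁆ᵛ : {xs : Vec (Fin n) k} → u ∈ᵛ xs → u ∈ ⁅ xs ⁆ᵛ
∈ᵛ⇒∈⁅⁆ᵛ (here refl) = x∈p∪q⁺ (inj₁ (x∈⁅x⁆ _))
∈ᵛ⇒∈⁅⁆ᵛ (there u∈xs) = x∈p∪q⁺ (inj₂ (∈ᵛ⇒∈⁅⁆ᵛ u∈xs))

∈⁅⁆ᵛ⇒∈ᵛ : (xs : Vec (Fin n) k) → u ∈ ⁅ xs ⁆ᵛ → u ∈ᵛ xs
∈⁅⁆ᵛ⇒∈ᵛ []       u∈∅ = ⊥-elim (∉⊥ u∈∅)
∈⁅⁆ᵛ⇒∈ᵛ (x ∷ xs) u∈ with x∈p∪q⁻ ⁅ x ⁆ ⁅ xs ⁆ᵛ u∈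
... | inj₁ u∈⁅x⁆ = here (x∈⁅y⁆⇒x≡y x u∈⁅x⁆)
... | inj₂ u∈xs  = there (∈⁅⁆ᵛ⇒∈ᵛ xs u∈xs)

module PushClass (G : Digraph n) (G-oriented : IsOriented G) where

  Member : Digraph n → Set
  Member = PushEquivalent G

  member-self : Member G
  member-self = (λ _ → false) , λ _ _ → refl

  member-push : Member H → ∀ T → Member (push T H)
  member-push (S , H≡) T = (λ i → T i xor S i) , λ u w → trans (push-cong T H≡ u w) (push-push T S G u w)

  member-adj : Member H → ∀ u w → adj H u w ≡ adj G u w
  member-adj (S , H≡) u w rewrite H≡ u w | H≡ w u = adj-push S G u w

  member-oriented : Member H → IsOriented H
  member-oriented (S , H≡) = oriented-resp H≡ (push-oriented S G-oriented)

  member-arc⇒adj : Member H → H u w ≡ true → adj G u w ≡ true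
  member-arc⇒adj {H = H} {u = u} {w = w} H-member u→w =
    trans (sym (member-adj H-member u w)) (arc⇒adj {K = H} u→w)

  member-nonadjacent : Member H → adj G u w ≡ false → H u w ≡ false
  member-nonadjacent {H = H} {u = u} {w = w} H-member u≁w =
    nonadjacent⇒no-arc {K = H} (trans (member-adj H-member u w) u≁w)

  member-reverse : Member H → adj G u w ≡ true → H u w ≡ false → H w u ≡ true
  member-reverse {H = H} {u = u} {w = w} H-member u∼w u↛w =
    trans (converse-arc (member-oriented H-member) (trans (member-adj H-member u w) u∼w)) (cong not u↛w)

  orient-toward : Member K → adj G x z ≡ true →
    ∃ λ K′ → Member K′ × K′ x z ≡ true × (∀ a b → a ≢ z → b ≢ z → K′ a b ≡ K a b)
  orient-toward {K = K} {x = x} {z = z} K-member x∼z with K x z in x→z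
  ... | true  = K , K-member , x→z , λ _ _ _ _ → refl
  ... | false = push ⁅ z ⁆ᵇ K , member-push K-member ⁅ z ⁆ᵇ ,
                trans (push-single-in K (adjacent⇒distinct G-oriented x∼z)) (member-reverse K-member x∼z x→z) ,
                λ a b → push-single-away K

  EnteredWithin : Pred (Fin n) 0ℓ → Subset n → Digraph n → Set
  EnteredWithin P R K = ∀ u → u ∈ R → P u ⊎ ∃ λ x → x ∈ R × K x u ≡ true

  EnteredOutside : Pred (Fin n) 0ℓ → Set
  EnteredOutside P = ∃ λ K → Member K × ∀ u → P u ⊎ ∃ λ x → K x u ≡ true

  entered-within-list : {xs : Vec (Fin n) k} {P : Pred (Fin n) 0ℓ} →
    (∀ {u} → u ∈ᵛ xs → ∃ λ x → x ∈ᵛ xs × K x u ≡ true) → EnteredWithin P ⁅ xs ⁆ᵛ K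
  entered-within-list {xs = xs} predecessor u u∈ with predecessor (∈⁅⁆ᵛ⇒∈ᵛ xs u∈)
  ... | x , x∈xs , x→u = inj₂ (x , ∈ᵛ⇒∈⁅⁆ᵛ x∈xs , x→u)

  module Spreading (G-connected : Connected G) where

    root : Fin n
    root = fromℕ< (Connected.nonempty G-connected)

    in-neighbours : Fin n → Bool
    in-neighbours u = G u root

    H₀ : Digraph n
    H₀ = push in-neighbours G

    H₀-member : Member H₀
    H₀-member = member-push member-self in-neighbours

    H₀-source : IsSource H₀ root
    H₀-source = push-in-neighbours-source G-oriented

    grow : {P : Pred (Fin n) 0ℓ} {R : Subset n} → ∀ k → n ≤ k + ∣ R ∣ →
      Member K → r ∈ R → EnteredWithin P R K → EnteredOutside P
    grow {K = K} {P = P} {R = R} k bound K-member r∈R entered with any? (λ y → ¬? (y ∈? R))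
    ... | no ∄y = K , K-member , λ u → forget (entered u (decidable-stable (u ∈? R) λ u∉R → ∄y (u , u∉R)))
      where
      forget : ∀ {u} → P u ⊎ ∃ (λ x → x ∈ R × K x u ≡ true) → P u ⊎ ∃ λ x → K x u ≡ true
      forget (inj₁ pu)             = inj₁ pu
      forget (inj₂ (x , _ , x→u)) = inj₂ (x , x→u)
    ... | yes (y , y∉R) with exit (_∈? R) (Connected.walk G-connected _ y) r∈R y∉R
    ... | x , z , x∈R , z∉R , x∼z with orient-toward K-member x∼z
    ... | K′ , K′-member , x→z , agree = continue k bound
      where
      R′ : Subset n
      R′ = R ∪ ⁅ z ⁆

      R⊆R′ : ∀ {u} → u ∈ R → u ∈ R′
      R⊆R′ = p⊆p∪q ⁅ z ⁆

      growth : ∣ R ∣ < ∣ R′ ∣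
      growth = p⊂q⇒∣p∣<∣q∣ (R⊆R′ , z , x∈p∪q⁺ (inj₂ (x∈⁅x⁆ z)) , z∉R)

      ∈R⇒≢z : ∀ {u} → u ∈ R → u ≢ z
      ∈R⇒≢z u∈R refl = z∉R u∈R

      entered′ : EnteredWithin P R′ K′
      entered′ u u∈R′ with x∈p∪q⁻ R ⁅ z ⁆ u∈R′
      ... | inj₂ u∈⁅z⁆ rewrite x∈⁅y⁆⇒x≡y z u∈⁅z⁆ = inj₂ (x , R⊆R′ x∈R , x→z)
      ... | inj₁ u∈R with entered u u∈R
      ...   | inj₁ pu = inj₁ pu
      ...   | inj₂ (a , a∈R , a→u) = inj₂ (a , R⊆R′ a∈R , trans (agree a u (∈R⇒≢z a∈R) (∈R⇒≢z u∈R)) a→u)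

      continue : ∀ k → n ≤ k + ∣ R ∣ → EnteredOutside P
      continue zero    bound = ⊥-elim (<⇒≱ (≤-trans growth (∣p∣≤n R′)) bound)
      continue (suc k) bound = grow k bound′ K′-member (R⊆R′ r∈R) entered′
        where
        open ≤-Reasoning
        bound′ : n ≤ k + ∣ R′ ∣
        bound′ = begin
          n                ≤⟨ bound ⟩
          suc k + ∣ R ∣    ≡⟨ sym (+-suc k ∣ R ∣) ⟩
          k + suc ∣ R ∣    ≤⟨ +-monoʳ-≤ k growth ⟩
          k + ∣ R′ ∣       ∎

    spread : {P : Pred (Fin n) 0ℓ} {R : Subset n} → Member K → r ∈ R → EnteredWithin P R K → EnteredOutside P
    spread = grow _ (m≤m+n n _)

    some-member-has-at-most-one-source : ∃ λ K → Member K × AtMostOneSource K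
    some-member-has-at-most-one-source
      with spread member-self (x∈⁅x⁆ root) (λ u u∈⁅root⁆ → inj₁ (x∈⁅y⁆⇒x≡y root u∈⁅root⁆))
    ... | K , K-member , entered = K , K-member , λ a-source b-source → trans (is-root a-source) (sym (is-root b-source))
      where
      is-root : IsSource K a → a ≡ root
      is-root {a = a} a-source with entered a
      ... | inj₁ a≡root = a≡root
      ... | inj₂ (x , x→a) = ⊥-elim (true≢false (trans (sym x→a) (a-source x)))

    module Rigid (G-rigid : (H : Digraph n) → Member H → Isomorphic G H) where

      member-has-source : Member H → ∃ (IsSource H)
      member-has-source {H = H} H-member =
        _ , source-iso {H = H} (G-rigid H H-member) (source-iso {G = H₀} {H = G} (iso-sym (G-rigid H₀ H₀-member)) H₀-source)

      at-most-one-source : Member H → AtMostOneSource H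
      at-most-one-source {H = H} H-member with some-member-has-at-most-one-source
      ... | K , K-member , K-unique =
        at-most-one-source-iso {G = H} (iso-sym (G-rigid H H-member))
          (at-most-one-source-iso {G = G} {H = K} (G-rigid K K-member) K-unique)

      no-self-entered-set : Member K → (xs : Vec (Fin n) (suc k)) →
        (∀ {u} → u ∈ᵛ xs → ∃ λ x → x ∈ᵛ xs × K x u ≡ true) → ⊥
      no-self-entered-set K-member xs@(_ ∷ _) predecessor
        with spread {P = λ _ → ⊥} K-member (∈ᵛ⇒∈⁅⁆ᵛ {xs = xs} (here refl)) (entered-within-list predecessor)
      ... | K′ , K′-member , entered with member-has-source K′-member
      ...   | s , s-source with entered s
      ...     | inj₂ (x , x→s) = true≢false (trans (sym x→s) (s-source x))

      no-directed-triangle : Member K → K x y ≡ true → K y z ≡ true → K z x ≡ true → ⊥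
      no-directed-triangle {x = x} {y = y} {z = z} K-member x→y y→z z→x =
        no-self-entered-set K-member (x ∷ y ∷ z ∷ []) λ where
          (here refl)                 → z , there (there (here refl)) , z→x
          (there (here refl))         → x , here refl , x→y
          (there (there (here refl))) → y , there (here refl) , y→z

      no-directed-square : Member K → K x y ≡ true → K y z ≡ true → K z w ≡ true → K w x ≡ true → ⊥
      no-directed-square {x = x} {y = y} {z = z} {w = w} K-member x→y y→z z→w w→x =
        no-self-entered-set K-member (x ∷ y ∷ z ∷ w ∷ []) λ where
          (here refl)                         → w , there (there (there (here refl))) , w→x
          (there (here refl))                 → x , here refl , x→y
          (there (there (here refl)))         → y , there (here refl) , y→z
          (there (there (there (here refl)))) → z , there (there (here refl)) , z→w

      -- The neighbourhood of a source

      module Around (v : Fin n) where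

        Neighbour : Pred (Fin n) 0ℓ
        Neighbour u = adj G v u ≡ true

        Outer : Pred (Fin n) 0ℓ
        Outer u = u ≢ v × adj G v u ≡ false

        neighbour? : Decidable Neighbour
        neighbour? u = adj G v u ≟ᵇ true

        outer? : Decidable Outer
        outer? u = ¬? (u ≟ v) ×-dec (adj G v u ≟ᵇ false)

        data Position (u : Fin n) : Set where
          centre    : u ≡ v → Position u
          neighbour : Neighbour u → Position u
          outer     : Outer u → Position u

        position : ∀ u → Position u
        position u with u ≟ v | adj G v u in e
        ... | yes u≡v | _     = centre u≡v
        ... | no  _   | true  = neighbour e
        ... | no  u≢v | false = outer (u≢v , e)

        neighbour≢centre : Neighbour u → u ≢ v
        neighbour≢centre u∼v refl = adjacent⇒distinct G-oriented u∼v refl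

        outer≢neighbour : Outer z → Neighbour u → z ≢ u
        outer≢neighbour (_ , z≁v) u∼v refl = true≢false (trans (sym u∼v) z≁v)

        closedNbhd : Fin n → Bool
        closedNbhd u = adj G v u ∨ does (u ≟ v)

        closedNbhd-centre : closedNbhd v ≡ true
        closedNbhd-centre rewrite adj-irreflexive {u = v} G-oriented = dec-true (v ≟ v) refl

        closedNbhd-neighbour : Neighbour u → closedNbhd u ≡ true
        closedNbhd-neighbour u∼v rewrite u∼v = refl

        closedNbhd-outer : Outer u → closedNbhd u ≡ false
        closedNbhd-outer {u = u} (u≢v , u≁v) rewrite u≁v = dec-false (u ≟ v) u≢v

        outerPart : (Fin n → Bool) → Fin n → Bool
        outerPart T u = not (closedNbhd u) ∧ T u

        outerPart-closed : ∀ T → closedNbhd u ≡ true → outerPart T u ≡ false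
        outerPart-closed T e rewrite e = refl

        outerPart-outer : ∀ T → Outer u → outerPart T u ≡ T u
        outerPart-outer T u-outer rewrite closedNbhd-outer u-outer = refl

        record Rooted (H : Digraph n) : Set where
          field
            member : Member H
            source : IsSource H v

          oriented : IsOriented H
          oriented = member-oriented member

        open Rooted

        rooted-push : Rooted H → ∀ S → (∀ a → Neighbour a → S a ≡ S v) → Rooted (push S H)
        rooted-push {H = H} ρ S constant = record { member = member-push (member ρ) S ; source = source′ }
          where
          source′ : IsSource (push S H) v
          source′ a with adj G v a ≟ᵇ true
          ... | yes a∼v = trans (push-inside S H (constant a a∼v) refl) (source ρ a)
          ... | no  a≁v = push-nonadjacent S H (trans (member-adj (member ρ) a v) (trans (adj-sym G a v) (¬-not a≁v)))

        rooted-outerPart : Rooted H → ∀ T → Rooted (push (outerPart T) H)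
        rooted-outerPart ρ T = rooted-push ρ (outerPart T) λ a a∼v →
          trans (outerPart-closed T (closedNbhd-neighbour a∼v)) (sym (outerPart-closed T closedNbhd-centre))

        rooted-closedNbhd : Rooted H → Rooted (push closedNbhd H)
        rooted-closedNbhd ρ = rooted-push ρ closedNbhd λ a a∼v →
          trans (closedNbhd-neighbour a∼v) (sym closedNbhd-centre)

        arc-from-centre : Rooted H → Neighbour x → H v x ≡ true
        arc-from-centre {x = x} ρ x∼v =
          member-reverse (member ρ) (trans (adj-sym G x v) x∼v) (source ρ x)

        no-arc-between-neighbours : Rooted H → Neighbour x → Neighbour y → H x y ≡ false
        no-arc-between-neighbours {H = H} {x = x} {y = y} ρ x∼v y∼v with H x y in x→y
        ... | false = refl
        ... | true  = ⊥-elim (no-directed-triangle (member-push (member ρ) ⁅ x ⁆ᵇ) v→y y→x x→v)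
          where
          v≢x : v ≢ x
          v≢x = neighbour≢centre x∼v ∘ sym
          y≢x : y ≢ x
          y≢x = adjacent⇒distinct (oriented ρ) (arc⇒adj {K = H} x→y) ∘ sym
          v→y : push ⁅ x ⁆ᵇ H v y ≡ true
          v→y = trans (push-single-away H v≢x y≢x) (arc-from-centre ρ y∼v)
          y→x : push ⁅ x ⁆ᵇ H y x ≡ true
          y→x = trans (push-single-in H y≢x) x→y
          x→v : push ⁅ x ⁆ᵇ H x v ≡ true
          x→v = trans (push-single-out H v≢x) (arc-from-centre ρ x∼v)

        neighbours-nonadjacent : Rooted H → Neighbour x → Neighbour y → adj G x y ≡ false
        neighbours-nonadjacent {x = x} {y = y} ρ x∼v y∼v =
          trans (sym (member-adj (member ρ) x y))
                (cong₂ _∨_ (no-arc-between-neighbours ρ x∼v y∼v) (no-arc-between-neighbours ρ y∼v x∼v))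

        OnlyCentreEnters : Digraph n → Fin n → Set
        OnlyCentreEnters H x = ∀ a → a ≢ v → H a x ≡ false

        only-centre-enters-unique : Rooted H → Neighbour x → Neighbour y → OnlyCentreEnters H x → OnlyCentreEnters H y → x ≡ y
        only-centre-enters-unique {H = H} ρ x∼v y∼v x-only-centre y-only-centre =
          at-most-one-source (member-push (member ρ) ⁅ v ⁆ᵇ) (source-after x∼v x-only-centre) (source-after y∼v y-only-centre)
          where
          source-after : Neighbour u → OnlyCentreEnters H u → IsSource (push ⁅ v ⁆ᵇ H) u
          -- `a ≟ v` would also be abstracted inside ⁅ v ⁆ᵇ a in the goal.
          source-after {u = u} u∼v u-only-centre a with v ≟ a
          ... | yes refl = trans (push-single-out H (neighbour≢centre u∼v)) (source ρ u)
          ... | no  v≢a  = trans (push-single-away H (v≢a ∘ sym) (neighbour≢centre u∼v)) (u-only-centre a (v≢a ∘ sym))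

        neighbours-not-all-entered : Rooted H → Neighbour x →
          (∀ u → Neighbour u → ∃ λ a → a ≢ v × H a u ≡ true) → ⊥
        neighbours-not-all-entered {H = H} {x = x} ρ x∼v entered
          with member-has-source (member-push (member ρ) ⁅ v ⁆ᵇ)
        ... | s , s-source with position s
        ...   | centre refl =
          true≢false (trans (sym (arc-from-centre ρ x∼v)) (trans (sym (push-single-in H (neighbour≢centre x∼v))) (s-source x)))
        ...   | neighbour s∼v with entered s s∼v
        ...     | a , a≢v , a→s =
          true≢false (trans (sym a→s) (trans (sym (push-single-away H a≢v (neighbour≢centre s∼v))) (s-source a)))
        neighbours-not-all-entered {H = H} ρ x∼v entered | s , s-source | outer s-outer =
          proj₁ s-outer (at-most-one-source (member ρ) s-source-in-H (source ρ))
          where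
          s-source-in-H : IsSource H s
          s-source-in-H a with a ≟ v
          ... | yes refl = member-nonadjacent (member ρ) (proj₂ s-outer)
          ... | no  a≢v  = trans (sym (push-single-away H a≢v (proj₁ s-outer))) (s-source a)

        outer-entered : Rooted H → Outer z → ∃ λ x → Neighbour x × H x z ≡ true
        outer-entered {H = H} {z = z} ρ z-outer
          with any? (λ x → neighbour? x ×-dec (H x z ≟ᵇ true))
        ... | yes (x , x∼v , x→z) = x , x∼v , x→z
        -- Otherwise pushing the outer in-neighbours of z makes z a second source.
        ... | no ∄x = ⊥-elim (proj₁ z-outer (sym (at-most-one-source (member ρ′) (source ρ′) z-source)))
          where
          into-z : Fin n → Bool
          into-z u = H u z
          ρ′ : Rooted (push (outerPart into-z) H)
          ρ′ = rooted-outerPart ρ into-z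
          z-fixed : outerPart into-z z ≡ false
          z-fixed = trans (outerPart-outer into-z z-outer) (IsOriented.noLoop (oriented ρ) z)
          z-source : IsSource (push (outerPart into-z) H) z
          z-source a with position a
          ... | centre refl = push-nonadjacent (outerPart into-z) H (trans (member-adj (member ρ) v z) (proj₂ z-outer))
          ... | neighbour a∼v = trans (push-inside (outerPart into-z) H (outerPart-closed into-z (closedNbhd-neighbour a∼v)) z-fixed)
                                      (¬-not λ a→z → ∄x (a , a∼v , a→z))
          ... | outer a-outer with H a z ≟ᵇ true
          ...   | yes a→z = trans (push-across (outerPart into-z) H (trans (outerPart-outer into-z a-outer) a→z) z-fixed)
                                  (IsOriented.asym (oriented ρ) a z a→z)
          ...   | no  a↛z = trans (push-inside (outerPart into-z) H (trans (outerPart-outer into-z a-outer) (¬-not a↛z)) z-fixed)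
                                  (¬-not a↛z)

        -- Pushing N[v] keeps v a source and reverses exactly the arcs between N(v) and the outer vertices.
        outer-enters : Rooted H → Outer z → ∃ λ x → Neighbour x × H z x ≡ true
        outer-enters {H = H} ρ z-outer with outer-entered (rooted-closedNbhd ρ) z-outer
        ... | x , x∼v , x→z = x , x∼v ,
          trans (sym (push-across closedNbhd H (closedNbhd-neighbour x∼v) (closedNbhd-outer z-outer))) x→z

        outer-sees-two : Rooted H → Outer z →
          ∃₂ λ p q → p ≢ q × Neighbour p × Neighbour q × H p z ≡ true × H z q ≡ true
        outer-sees-two {H = H} {z = z} ρ z-outer with outer-entered ρ z-outer | outer-enters ρ z-outer
        ... | p , p∼v , p→z | q , q∼v , z→q = p , q , p≢q , p∼v , q∼v , p→z , z→q
          where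
          p≢q : p ≢ q
          p≢q refl = true≢false (trans (sym z→q) (IsOriented.asym (oriented ρ) p z p→z))

        outer-entered-once : Rooted H → Outer z → x ≢ y → Neighbour x → Neighbour y →
          H x z ≡ true → H y z ≡ true → ⊥
        outer-entered-once {H = H} {z = z} {x = x} {y = y} ρ z-outer x≢y x∼v y∼v x→z y→z =
          no-directed-square (member-push (member ρ) ⁅ y ⁆ᵇ) v→x x→z′ z→y y→v
          where
          v≢y : v ≢ y
          v≢y = neighbour≢centre y∼v ∘ sym
          z≢y : z ≢ y
          z≢y = outer≢neighbour z-outer y∼v
          v→x : push ⁅ y ⁆ᵇ H v x ≡ true
          v→x = trans (push-single-away H v≢y x≢y) (arc-from-centre ρ x∼v)
          x→z′ : push ⁅ y ⁆ᵇ H x z ≡ true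
          x→z′ = trans (push-single-away H x≢y z≢y) x→z
          z→y : push ⁅ y ⁆ᵇ H z y ≡ true
          z→y = trans (push-single-in H z≢y) y→z
          y→v : push ⁅ y ⁆ᵇ H y v ≡ true
          y→v = trans (push-single-out H v≢y) (arc-from-centre ρ y∼v)

        outer-arcs-differ : Rooted H → Outer z → x ≢ y → Neighbour x → Neighbour y →
          adj G z x ≡ true → adj G z y ≡ true → H z x ≢ H z y
        outer-arcs-differ {H = H} {z = z} {x = x} {y = y} ρ z-outer x≢y x∼v y∼v z∼x z∼y same
          with H z x ≟ᵇ true
        ... | no z↛x = outer-entered-once ρ z-outer x≢y x∼v y∼v
                         (member-reverse (member ρ) z∼x (¬-not z↛x))
                         (member-reverse (member ρ) z∼y (trans (sym same) (¬-not z↛x)))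
        ... | yes z→x = outer-entered-once (rooted-outerPart ρ ⁅ z ⁆ᵇ) z-outer x≢y x∼v y∼v
                          (reversed x∼v z→x) (reversed y∼v (trans (sym same) z→x))
          where
          reversed : Neighbour t → H z t ≡ true → push (outerPart ⁅ z ⁆ᵇ) H t z ≡ true
          reversed t∼v z→t = trans
            (push-across (outerPart ⁅ z ⁆ᵇ) H (outerPart-closed ⁅ z ⁆ᵇ (closedNbhd-neighbour t∼v))
                         (trans (outerPart-outer ⁅ z ⁆ᵇ z-outer) (⁅⁆ᵇ-self z)))
            z→t

        outer-sees-at-most-two : Rooted H → Outer z → x ≢ y → x ≢ w → y ≢ w →
          Neighbour x → Neighbour y → Neighbour w →
          adj G z x ≡ true → adj G z y ≡ true → adj G z w ≡ true → ⊥
        outer-sees-at-most-two {H = H} {z = z} {x = x} {y = y} {w = w}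
          ρ z-outer x≢y x≢w y≢w x∼v y∼v w∼v z∼x z∼y z∼w with bool-pigeonhole (H z x) (H z y) (H z w)
        ... | inj₁ same        = outer-arcs-differ ρ z-outer x≢y x∼v y∼v z∼x z∼y same
        ... | inj₂ (inj₁ same) = outer-arcs-differ ρ z-outer y≢w y∼v w∼v z∼y z∼w same
        ... | inj₂ (inj₂ same) = outer-arcs-differ ρ z-outer x≢w x∼v w∼v z∼x z∼w same

        outerPart-arc : Rooted H → ∀ T → Outer z → Neighbour t → adj G z t ≡ true →
          push (outerPart T) H z t ≡ T z xor H z t
        outerPart-arc {H = H} {z = z} {t = t} ρ T z-outer t∼v z∼t = begin
          push (outerPart T) H z t                     ≡⟨ push-adjacent (outerPart T) (oriented ρ) z∼t-in-H ⟩
          (outerPart T z xor outerPart T t) xor H z t  ≡⟨ cong₂ (λ p q → (p xor q) xor H z t)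
                                                              (outerPart-outer T z-outer)
                                                              (outerPart-closed T (closedNbhd-neighbour t∼v)) ⟩
          (T z xor false) xor H z t                    ≡⟨ cong (_xor H z t) (xor-identityʳ (T z)) ⟩
          T z xor H z t                                ∎
          where
          open ≡-Reasoning
          z∼t-in-H : adj H z t ≡ true
          z∼t-in-H = trans (member-adj (member ρ) z t) z∼t

        outer-avoids-after-push : Rooted H → ∀ T → Outer z → Neighbour t → adj G z t ≡ true →
          T z ≡ H z t → push (outerPart T) H z t ≡ false
        outer-avoids-after-push {H = H} {z = z} {t = t} ρ T z-outer t∼v z∼t Tz =
          trans (outerPart-arc ρ T z-outer t∼v z∼t) (trans (cong (_xor H z t) Tz) (xor-same (H z t)))

        outer-enters-after-push : Rooted H → ∀ T → Outer z → Neighbour t → adj G z t ≡ true →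
          T z ≡ H t z → push (outerPart T) H z t ≡ true
        outer-enters-after-push {H = H} {z = z} {t = t} ρ T z-outer t∼v z∼t Tz =
          trans (outerPart-arc ρ T z-outer t∼v z∼t)
                (trans (cong (_xor H z t) (trans Tz (converse-arc (oriented ρ) z∼t-in-H))) (xor-inverseˡ (H z t)))
          where
          z∼t-in-H : adj H z t ≡ true
          z∼t-in-H = trans (member-adj (member ρ) z t) z∼t

        only-centre-enters-after-push : Rooted H → ∀ T → Neighbour t →
          (∀ a → Outer a → adj G a t ≡ true → T a ≡ H a t) → OnlyCentreEnters (push (outerPart T) H) t
        only-centre-enters-after-push {H = H} {t = t} ρ T t∼v agrees a a≢v with position a
        ... | centre a≡v    = ⊥-elim (a≢v a≡v)
        ... | neighbour a∼v =
          trans (push-inside (outerPart T) H (outerPart-closed T (closedNbhd-neighbour a∼v))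
                                           (outerPart-closed T (closedNbhd-neighbour t∼v)))
                (no-arc-between-neighbours ρ a∼v t∼v)
        ... | outer a-outer with adj G a t ≟ᵇ true
        ...   | yes a∼t = outer-avoids-after-push ρ T a-outer t∼v a∼t (agrees a a-outer a∼t)
        ...   | no  a≁t = push-nonadjacent (outerPart T) H (trans (member-adj (member ρ) a t) (¬-not a≁t))

        common-outer-neighbour : Rooted H → x ≢ y → Neighbour x → Neighbour y →
          ∃ λ z → Outer z × adj G z x ≡ true × adj G z y ≡ true
        common-outer-neighbour {H = H} {x = x} {y = y} ρ x≢y x∼v y∼v
          with any? (λ z → outer? z ×-dec (adj G z x ≟ᵇ true) ×-dec (adj G z y ≟ᵇ true))
        ... | yes (z , z-outer , z∼x , z∼y) = z , z-outer , z∼x , z∼y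
        -- Otherwise pushing the outer in-neighbours of x and y leaves both entered only from v.
        ... | no ∄z = ⊥-elim (x≢y (only-centre-enters-unique (rooted-outerPart ρ into-x-or-y) x∼v y∼v
                             (only-centre-enters-after-push ρ into-x-or-y x∼v only-x)
                             (only-centre-enters-after-push ρ into-x-or-y y∼v only-y)))
          where
          into-x-or-y : Fin n → Bool
          into-x-or-y u = H u x ∨ H u y
          only-x : ∀ a → Outer a → adj G a x ≡ true → into-x-or-y a ≡ H a x
          only-x a a-outer a∼x =
            trans (cong (H a x ∨_) (member-nonadjacent (member ρ) (¬-not λ a∼y → ∄z (a , a-outer , a∼x , a∼y))))
                  (∨-identityʳ (H a x))
          only-y : ∀ a → Outer a → adj G a y ≡ true → into-x-or-y a ≡ H a y
          only-y a a-outer a∼y =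
            cong (_∨ H a y) (member-nonadjacent (member ρ) (¬-not λ a∼x → ∄z (a , a-outer , a∼x , a∼y)))

        at-most-two-neighbours : Rooted H → x ≢ y → x ≢ w → y ≢ w →
          Neighbour x → Neighbour y → Neighbour w → ⊥
        at-most-two-neighbours {H = H} {x = x} {y = y} {w = w} ρ x≢y x≢w y≢w x∼v y∼v w∼v =
          neighbours-not-all-entered (rooted-outerPart ρ orientation) x∼v entered
          where
          -- An outer vertex sees at most two neighbours of v, by opposite arcs, and chooses which one
          -- it enters: x if it also sees y, y if it sees y but not x, and otherwise not x.
          orientation : Fin n → Bool
          orientation z = if adj G z x then (if adj G z y then H x z else H z x) else H y z

          entered : ∀ u → Neighbour u → ∃ λ a → a ≢ v × push (outerPart orientation) H a u ≡ true
          entered u u∼v with u ≟ x | u ≟ y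
          ... | yes refl | _ with common-outer-neighbour ρ x≢y x∼v y∼v
          ...   | z , z-outer , z∼x , z∼y =
            z , proj₁ z-outer , outer-enters-after-push ρ orientation z-outer x∼v z∼x oz
            where
            oz : orientation z ≡ H x z
            oz rewrite z∼x | z∼y = refl
          entered u u∼v | no _ | yes refl with common-outer-neighbour ρ y≢w y∼v w∼v
          ...   | z , z-outer , z∼y , z∼w =
            z , proj₁ z-outer , outer-enters-after-push ρ orientation z-outer y∼v z∼y oz
            where
            z≁x : adj G z x ≡ false
            z≁x = ¬-not λ z∼x → outer-sees-at-most-two ρ z-outer x≢y x≢w y≢w x∼v y∼v w∼v z∼x z∼y z∼w
            oz : orientation z ≡ H y z
            oz rewrite z≁x = refl
          entered u u∼v | no u≢x | no u≢y with common-outer-neighbour ρ (u≢x ∘ sym) x∼v u∼v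
          ...   | z , z-outer , z∼x , z∼u =
            z , proj₁ z-outer , outer-enters-after-push ρ orientation z-outer u∼v z∼u oz
            where
            z≁y : adj G z y ≡ false
            z≁y = ¬-not λ z∼y → outer-sees-at-most-two ρ z-outer (u≢x ∘ sym) x≢y (u≢y)
                                  x∼v u∼v y∼v z∼x z∼u z∼y
            oz′ : orientation z ≡ H z x
            oz′ rewrite z∼x | z≁y = refl
            oz : orientation z ≡ H u z
            oz = begin
              orientation z   ≡⟨ oz′ ⟩
              H z x           ≡⟨ ¬-not (outer-arcs-differ ρ z-outer (u≢x ∘ sym) x∼v u∼v z∼x z∼u) ⟩
              not (H z u)     ≡⟨ sym (converse-arc (oriented ρ) (trans (member-adj (member ρ) z u) z∼u)) ⟩
              H u z           ∎
              where open ≡-Reasoning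

        outer-adjacent-to-both : Rooted H → (∀ u → Neighbour u → u ≡ x ⊎ u ≡ y) → Outer z →
          adj G z x ≡ true × adj G z y ≡ true
        outer-adjacent-to-both {z = z} ρ x-or-y z-outer with outer-sees-two ρ z-outer
        ... | p , q , p≢q , p∼v , q∼v , p→z , z→q with x-or-y p p∼v | x-or-y q q∼v
        ...   | inj₁ refl | inj₂ refl = trans (adj-sym G z p) (member-arc⇒adj (member ρ) p→z) ,
                                       member-arc⇒adj (member ρ) z→q
        ...   | inj₂ refl | inj₁ refl = member-arc⇒adj (member ρ) z→q ,
                                       trans (adj-sym G z p) (member-arc⇒adj (member ρ) p→z)
        ...   | inj₁ refl | inj₁ refl = ⊥-elim (p≢q refl)
        ...   | inj₂ refl | inj₂ refl = ⊥-elim (p≢q refl)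

        at-most-one-outer : Rooted H → Neighbour x → Neighbour y → (∀ u → Neighbour u → u ≡ x ⊎ u ≡ y) →
          Outer z₁ → Outer z₂ → z₁ ≡ z₂
        at-most-one-outer {H = H} {x = x} {y = y} {z₁ = z₁} {z₂ = z₂} ρ x∼v y∼v x-or-y z₁-outer z₂-outer =
          decidable-stable (z₁ ≟ z₂) λ z₁≢z₂ →
            neighbours-not-all-entered (rooted-outerPart ρ orientation) x∼v (entered z₁≢z₂)
          where
          orientation : Fin n → Bool
          orientation z = if does (z ≟ z₁) then H x z else H y z

          entered : z₁ ≢ z₂ → ∀ u → Neighbour u → ∃ λ a → a ≢ v × push (outerPart orientation) H a u ≡ true
          entered z₁≢z₂ u u∼v with x-or-y u u∼v
          ... | inj₁ refl = z₁ , proj₁ z₁-outer ,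
            outer-enters-after-push ρ orientation z₁-outer x∼v (proj₁ (outer-adjacent-to-both ρ x-or-y z₁-outer))
              (cong (if_then H x z₁ else H y z₁) (dec-true (z₁ ≟ z₁) refl))
          ... | inj₂ refl = z₂ , proj₁ z₂-outer ,
            outer-enters-after-push ρ orientation z₂-outer y∼v (proj₂ (outer-adjacent-to-both ρ x-or-y z₂-outer))
              (cong (if_then H x z₂ else H y z₂) (dec-false (z₂ ≟ z₁) (z₁≢z₂ ∘ sym)))

module Classification (G : Digraph n) (G-oriented : IsOriented G) (G-connected : Connected G)
  (G-rigid : (H : Digraph n) → PushEquivalent G H → Isomorphic G H) where

  open PushClass G G-oriented
  open Spreading G-connected
  open Rigid G-rigid
  open Around root public

  ρ₀ : Rooted H₀
  ρ₀ = record { member = H₀-member ; source = H₀-source }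

  isolated⇒K1 : (∀ u → ¬ Neighbour u) → IsK1 G
  isolated⇒K1 isolated = enumeration (root ∷ []) ([] ∷ []) λ u → here (is-root u)
    where
    is-root : ∀ u → u ≡ root
    is-root u = decidable-stable (u ≟ root) λ u≢root →
      isolated _ (proj₂ (first-step (Connected.walk G-connected root u) (u≢root ∘ sym)))

  one-neighbour⇒K2 : Neighbour x → (∀ u → Neighbour u → u ≡ x) → IsOrientedK2 G
  one-neighbour⇒K2 {x = x} x∼v only-x =
    enumeration (root ∷ x ∷ []) (((neighbour≢centre x∼v ∘ sym) ∷ []) ∷ [] ∷ []) complete , x∼v
    where
    complete : ∀ u → u ∈ᵛ root ∷ x ∷ []
    complete u with position u
    ... | centre u≡v    = here u≡v
    ... | neighbour u∼v = there (here (only-x u u∼v))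
    ... | outer u-outer with outer-sees-two ρ₀ u-outer
    ...   | p , q , p≢q , p∼v , q∼v , _ = ⊥-elim (p≢q (trans (only-x p p∼v) (sym (only-x q q∼v))))

  two-neighbours⇒square : x ≢ y → Neighbour x → Neighbour y → (∀ u → Neighbour u → u ≡ x ⊎ u ≡ y) →
    IsNonDirectable4Cycle G
  two-neighbours⇒square {x = x} {y = y} x≢y x∼v y∼v x-or-y with common-outer-neighbour ρ₀ x≢y x∼v y∼v
  ... | z , z-outer , z∼x , z∼y = cycle , square , odd
    where
    complete : ∀ u → u ∈ᵛ root ∷ x ∷ z ∷ y ∷ []
    complete u with position u
    ... | centre u≡v    = here u≡v
    ... | neighbour u∼v with x-or-y u u∼v
    ...   | inj₁ u≡x = there (here u≡x)
    ...   | inj₂ u≡y = there (there (there (here u≡y)))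
    complete u | outer u-outer = there (there (here (at-most-one-outer ρ₀ x∼v y∼v x-or-y u-outer z-outer)))

    distinct : Unique (root ∷ x ∷ z ∷ y ∷ [])
    distinct = ((neighbour≢centre x∼v ∘ sym) ∷ (proj₁ z-outer ∘ sym) ∷ (neighbour≢centre y∼v ∘ sym) ∷ [])
             ∷ ((outer≢neighbour z-outer x∼v ∘ sym) ∷ x≢y ∷ [])
             ∷ (outer≢neighbour z-outer y∼v ∷ [])
             ∷ []
             ∷ []

    cycle : Fin 4 ↔ Fin n
    cycle = enumeration (root ∷ x ∷ z ∷ y ∷ []) distinct complete

    corner : Fin 4 → Fin n
    corner = Inverse.to cycle

    square : InducedSquare G corner
    square = square-adjacency G-oriented corner x∼v (trans (adj-sym G x z) z∼x) z∼y (trans (adj-sym G y root) y∼v)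
                              (proj₂ z-outer) (neighbours-nonadjacent ρ₀ x∼v y∼v)

    H₀-square : InducedSquare H₀ corner
    H₀-square i j = trans (member-adj (Rooted.member ρ₀) (corner i) (corner j)) (square i j)

    H₀-parity : forward-parity H₀ corner ≡ true
    H₀-parity = begin
      H₀ root x xor H₀ x z xor H₀ z y xor H₀ y root
        ≡⟨ cong₂ _xor_ (arc-from-centre ρ₀ x∼v)
             (cong₂ _xor_ (converse-arc (Rooted.oriented ρ₀) (H₀-square c2 c1))
               (cong₂ _xor_ (¬-not (outer-arcs-differ ρ₀ z-outer x≢y x∼v y∼v z∼x z∼y ∘ sym))
                            (Rooted.source ρ₀ y))) ⟩
      true xor z↛x xor z↛x xor false
        ≡⟨ cong (true xor_) (trans (cong (z↛x xor_) (xor-identityʳ z↛x)) (xor-same z↛x)) ⟩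
      true ∎
      where
      open ≡-Reasoning
      z↛x : Bool
      z↛x = not (H₀ z x)

    G-push-of-H₀ : PushEquivalent H₀ G
    G-push-of-H₀ = in-neighbours , λ u w → sym (push-involutive in-neighbours G u w)

    odd : (b2n (G root x) + b2n (G x z) + b2n (G z y) + b2n (G y root)) % 2 ≡ 1
    odd = trans (b2n-sum-parity (G root x) (G x z) (G z y) (G y root))
                (cong b2n (trans (forward-parity-push-equivalent (Rooted.oriented ρ₀) H₀-square G-push-of-H₀) H₀-parity))

mainTheorem7 : (n : ℕ) (G : Digraph n) → IsOriented G → Connected G →
    ((H : Digraph n) → PushEquivalent G H → Isomorphic G H) →
    IsK1 G ⊎ (IsOrientedK2 G ⊎ IsNonDirectable4Cycle G)
mainTheorem7 n G G-oriented G-connected G-rigid = by-neighbourhood-size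
  where
  open Classification G G-oriented G-connected G-rigid
  by-neighbourhood-size : IsK1 G ⊎ (IsOrientedK2 G ⊎ IsNonDirectable4Cycle G)
  by-neighbourhood-size with none-one-two-or-three neighbour?
  ... | inj₁ isolated = inj₁ (isolated⇒K1 isolated)
  ... | inj₂ (inj₁ (x , x∼v , only-x)) = inj₂ (inj₁ (one-neighbour⇒K2 x∼v only-x))
  ... | inj₂ (inj₂ (inj₁ (x , y , x≢y , x∼v , y∼v , x-or-y))) =
    inj₂ (inj₂ (two-neighbours⇒square x≢y x∼v y∼v x-or-y))
  ... | inj₂ (inj₂ (inj₂ (x , y , w , x≢y , x≢w , y≢w , x∼v , y∼v , w∼v))) =
    ⊥-elim (at-most-two-neighbours ρ₀ x≢y x≢w y≢w x∼v y∼v w∼v)
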